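{- The motion of a finite vertex-transitive graph is never an odd prime.
   Context: All graphs are finite, simple and undirected. The motion $\mu(\Gamma)$ of a graph $\Gamma$ is the minimum of $|\{v\in V\Gamma: v^x\ne v\}|$ over all non-identity automorphisms $x$ of $\Gamma$. -}

module Defs where

open import Data.Nat.Base using (ℕ; _≤_)
open import Data.Bool.Base using (Bool)
open import Data.Fin.Base using (Fin)
open import Data.Fin.Properties using (_≟_)
open import Data.Fin.Permutation using (Permutation′; _⟨$⟩ʳ_)
open import Data.List.Base using (List; filter; length)
open import Data.List.Base using () renaming (allFin to allFinL)
open import Data.Product.Base using (Σ; ∃; _×_; _,_)
open import Relation.Nullary using (¬_; ¬?)
open import Relation.Binary.PropositionalEquality using (_≡_; _≢_)

record Graph (n : ℕ) : Set where
  field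
    adj       : Fin n → Fin n → Bool
    adj-sym   : ∀ u v → adj u v ≡ adj v u
    adj-irrefl : ∀ v → adj v v ≡ Bool.false
open Graph public

IsAut : ∀ {n} → Graph n → Permutation′ n → Set
IsAut Γ σ = ∀ u v → adj Γ (σ ⟨$⟩ʳ u) (σ ⟨$⟩ʳ v) ≡ adj Γ u v

VertexTransitive : ∀ {n} → Graph n → Set
VertexTransitive {n} Γ =
  ∀ (u v : Fin n) → Σ (Permutation′ n) λ σ → IsAut Γ σ × (σ ⟨$⟩ʳ u ≡ v)

NonIdentity : ∀ {n} → Permutation′ n → Set
NonIdentity {n} σ = ∃ λ (v : Fin n) → σ ⟨$⟩ʳ v ≢ v

support : ∀ {n} → Permutation′ n → ℕ
support {n} σ = length (filter (λ v → ¬? ((σ ⟨$⟩ʳ v) ≟ v)) (allFinL n))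

MotionIs : ∀ {n} → Graph n → ℕ → Set
MotionIs {n} Γ m =
  (Σ (Permutation′ n) λ σ → IsAut Γ σ × NonIdentity σ × (support σ ≡ m))
  × (∀ (σ : Permutation′ n) → IsAut Γ σ → NonIdentity σ → m ≤ support σ)

{-# OPTIONS --safe #-}
module Submission where

-- Let σ be a non-identity automorphism moving the fewest vertices, p of them,
-- and let a be a vertex it moves, of period L.  An automorphism τ whose moved
-- vertices lie among those of σ and which fixes some vertex moved by σ has
-- smaller support, so τ = 1.  Applied to σᴸ and to σʲ (0 < j < L) this gives
-- σᴸ = 1 and shows that every vertex moved by σ has period exactly L, so
-- L ∣ p.  If p is prime then L = p: σ is a single p-cycle on the orbit of a and
-- fixes everything else.  The reflection σⁱ a ↦ σ⁻ⁱ a of that cycle is then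
-- an automorphism fixing a, and for p ≥ 3 it moves σ a, contradicting
-- minimality.

open import Defs
open import Level using (0ℓ)
open import Data.Fin.Base using (Fin; zero; suc; toℕ)
open import Data.Fin.Permutation using (Permutation′; _⟨$⟩ʳ_; _∘ₚ_; permutation)
import Data.Fin.Permutation as Perm
open import Data.Fin.Properties using (_≟_; suc-injective; pigeonhole; any?)
open import Data.List.Base using (length; filter; tabulate)
open import Data.Nat.Base using (ℕ; zero; suc; _+_; _∸_; _≤_; _<_; z≤n; s≤s; nonTrivial⇒n>1)
open import Data.Nat.Divisibility using (_∣_; _∣0; ∣-refl; ∣m∣n⇒∣m+n)
open import Data.Nat.Induction using (<-rec)
open import Data.Nat.Primality using (Prime; prime⇒irreducible; prime⇒nonTrivial)
open import Data.Nat.Properties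
  using ( _<?_; anyUpTo?; ≤-refl; ≤-antisym; <⇒≤; <⇒≱; ≮⇒≥; <-irrefl; ≤-<-trans
        ; n<1+n; m≤n⇒m≤1+n; m<n⇒m<1+n; m≤n⇒m<n∨m≡n; m<1+n⇒m<n∨m≡n
        ; +-comm; +-suc; +-identityʳ; +-monoʳ-<
        ; m∸n≤m; m∸n+n≡m; m+[n∸m]≡n; m∸[m∸n]≡n; m<n⇒0<n∸m; ∸-monoʳ-<
        ; module ≤-Reasoning )
open import Data.Product.Base using (∃; _×_; _,_; proj₁; proj₂)
open import Data.Sum.Base using (inj₁; inj₂; [_,_]′)
open import Function.Base using (_∘_; _$_; id)
open import Function.Bundles using (Injection)
open import Function.Properties.Inverse using (↔⇒↣)
open import Relation.Nullary using (¬_; ¬?; yes; no; contradiction)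
open import Relation.Nullary.Decidable using (_×-dec_; decidable-stable)
open import Relation.Unary using (Pred; Decidable; Empty; _∉_; _⊆_; _≐_; _∪_; _∩_; ∁; ｛_｝)
open import Relation.Unary.Properties using (_∩?_; ∁?)
open import Relation.Binary.PropositionalEquality
  using (_≡_; _≢_; refl; sym; trans; cong; cong₂; subst; module ≡-Reasoning)

count : ∀ {n} {P : Pred (Fin n) 0ℓ} → Decidable P → ℕ
count {n = zero}  P? = 0
count {n = suc n} P? with P? zero
... | yes _ = suc (count (P? ∘ suc))
... | no  _ = count (P? ∘ suc)

length-filter-tabulate : ∀ {n} {A : Set} {P : Pred A 0ℓ} (P? : Decidable P) (f : Fin n → A) →
                         length (filter P? (tabulate f)) ≡ count (P? ∘ f)
length-filter-tabulate {n = zero}  P? f = refl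
length-filter-tabulate {n = suc n} P? f with P? (f zero)
... | yes _ = cong suc (length-filter-tabulate P? (f ∘ suc))
... | no  _ = length-filter-tabulate P? (f ∘ suc)

count-mono : ∀ {n} {P Q : Pred (Fin n) 0ℓ} (P? : Decidable P) (Q? : Decidable Q) →
             P ⊆ Q → count P? ≤ count Q?
count-mono {n = zero}  P? Q? P⊆Q = z≤n
count-mono {n = suc n} P? Q? P⊆Q
  with P? zero | Q? zero | count-mono (P? ∘ suc) (Q? ∘ suc) P⊆Q
... | yes _  | yes _  | rest = s≤s rest
... | yes Pz | no ¬Qz | _    = contradiction (P⊆Q Pz) ¬Qz
... | no _   | yes _  | rest = m≤n⇒m≤1+n rest
... | no _   | no _   | rest = rest

count-≐ : ∀ {n} {P Q : Pred (Fin n) 0ℓ} (P? : Decidable P) (Q? : Decidable Q) →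
          P ≐ Q → count P? ≡ count Q?
count-≐ P? Q? (P⊆Q , Q⊆P) = ≤-antisym (count-mono P? Q? P⊆Q) (count-mono Q? P? Q⊆P)

count-partition : ∀ {n} {P Q : Pred (Fin n) 0ℓ} (Q? : Decidable Q) (P? : Decidable P) →
                  count Q? ≡ count (Q? ∩? P?) + count (Q? ∩? ∁? P?)
count-partition {n = zero}  Q? P? = refl
count-partition {n = suc n} Q? P?
  with Q? zero | P? zero | count-partition (Q? ∘ suc) (P? ∘ suc)
... | yes _ | yes _ | rest = cong suc rest
... | yes _ | no  _ | rest = trans (cong suc rest) (sym (+-suc _ _))
... | no  _ | yes _ | rest = rest
... | no  _ | no  _ | rest = rest

count-Empty : ∀ {n} {P : Pred (Fin n) 0ℓ} (P? : Decidable P) → Empty P → count P? ≡ 0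
count-Empty {zero}  P? ∅ = refl
count-Empty {suc n} P? ∅ with P? zero
... | yes Pz = contradiction Pz (∅ zero)
... | no  _  = count-Empty (P? ∘ suc) (∅ ∘ suc)

count-witness : ∀ {n} {P : Pred (Fin n) 0ℓ} (P? : Decidable P) {w} → P w → 0 < count P?
count-witness {suc n} P? {w} Pw with P? zero | w
... | yes _  | _     = s≤s z≤n
... | no ¬Pz | zero  = contradiction Pw ¬Pz
... | no _   | suc w = count-witness (P? ∘ suc) Pw

count-singleton : ∀ {n} (b : Fin n) → count (b ≟_) ≡ 1
count-singleton {suc n} zero = cong suc (count-Empty {n} ((zero ≟_) ∘ suc) λ _ ())
count-singleton (suc b) =
  trans (count-≐ ((suc b ≟_) ∘ suc) (b ≟_) (suc-injective , cong suc)) (count-singleton b)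

count-< : ∀ {n} {P Q : Pred (Fin n) 0ℓ} (P? : Decidable P) (Q? : Decidable Q) →
          P ⊆ Q → ∀ {w} → Q w → w ∉ P → count P? < count Q?
count-< P? Q? P⊆Q Qw w∉P = begin-strict
  count P?                                ≡⟨ count-≐ P? (Q? ∩? P?) ((λ Pv → P⊆Q Pv , Pv) , proj₂) ⟩
  count (Q? ∩? P?)                        ≡⟨ +-identityʳ _ ⟨
  count (Q? ∩? P?) + 0                    <⟨ +-monoʳ-< (count (Q? ∩? P?)) Q∖P-nonempty ⟩
  count (Q? ∩? P?) + count (Q? ∩? ∁? P?)  ≡⟨ count-partition Q? P? ⟨
  count Q?                                ∎
  where
  open ≤-Reasoning
  Q∖P-nonempty : 0 < count (Q? ∩? ∁? P?)
  Q∖P-nonempty = count-witness (Q? ∩? ∁? P?) (Qw , w∉P)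

count-insert : ∀ {n} {P Q : Pred (Fin n) 0ℓ} (P? : Decidable P) (Q? : Decidable Q) {b} →
               Q ≐ P ∪ ｛ b ｝ → b ∉ P → count Q? ≡ suc (count P?)
count-insert {P = P} {Q} P? Q? {b} (Q⊆P∪b , P∪b⊆Q) b∉P = begin
  count Q?                                ≡⟨ count-partition Q? P? ⟩
  count (Q? ∩? P?) + count (Q? ∩? ∁? P?)  ≡⟨ cong₂ _+_ (count-≐ (Q? ∩? P?) P? Q∩P≐P)
                                                       (count-≐ (Q? ∩? ∁? P?) (b ≟_) Q∖P≐b) ⟩
  count P? + count (b ≟_)                 ≡⟨ cong (count P? +_) (count-singleton b) ⟩
  count P? + 1                            ≡⟨ +-comm (count P?) 1 ⟩
  suc (count P?)                          ∎
  where
  open ≡-Reasoning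
  Q∩P≐P : (λ v → Q v × P v) ≐ P
  Q∩P≐P = proj₂ , λ Pv → P∪b⊆Q (inj₁ Pv) , Pv
  Q∖P≐b : (λ v → Q v × v ∉ P) ≐ ｛ b ｝
  Q∖P≐b = (λ { (Qv , v∉P) → [ (λ Pv → contradiction Pv v∉P) , id ]′ (Q⊆P∪b Qv) })
        , λ { refl → P∪b⊆Q (inj₂ refl) , b∉P }

least-witness : ∀ {P : Pred ℕ 0ℓ} → Decidable P → ∀ {m} → P m →
                ∃ λ n → P n × (∀ {k} → k < n → ¬ P k)
least-witness {P} P? {m} = <-rec (λ m → P m → Least) step m
  where
  Least : Set
  Least = ∃ λ n → P n × (∀ {k} → k < n → ¬ P k)
  step : ∀ m → (∀ {k} → k < m → P k → Least) → P m → Least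
  step m smaller Pm with anyUpTo? P? m
  ... | yes (k , k<m , Pk) = smaller k<m Pk
  ... | no  none           = m , Pm , λ k<m Pk → none (_ , k<m , Pk)

⟨$⟩ʳ-injective : ∀ {n} (π : Permutation′ n) {u v} → π ⟨$⟩ʳ u ≡ π ⟨$⟩ʳ v → u ≡ v
⟨$⟩ʳ-injective π = Injection.injective (↔⇒↣ π)

infixr 8 _^_

_^_ : ∀ {n} → Permutation′ n → ℕ → Permutation′ n
π ^ zero  = Perm.id
π ^ suc k = (π ^ k) ∘ₚ π

module _ {n} (π : Permutation′ n) where

  ^-+ : ∀ i j v → π ^ (i + j) ⟨$⟩ʳ v ≡ π ^ i ⟨$⟩ʳ (π ^ j ⟨$⟩ʳ v)
  ^-+ zero    j v = refl
  ^-+ (suc i) j v = cong (π ⟨$⟩ʳ_) (^-+ i j v)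

  ^-comm : ∀ i j v → π ^ i ⟨$⟩ʳ (π ^ j ⟨$⟩ʳ v) ≡ π ^ j ⟨$⟩ʳ (π ^ i ⟨$⟩ʳ v)
  ^-comm i j v = begin
    π ^ i ⟨$⟩ʳ (π ^ j ⟨$⟩ʳ v)  ≡⟨ sym (^-+ i j v) ⟩
    π ^ (i + j) ⟨$⟩ʳ v          ≡⟨ cong (λ k → π ^ k ⟨$⟩ʳ v) (+-comm i j) ⟩
    π ^ (j + i) ⟨$⟩ʳ v          ≡⟨ ^-+ j i v ⟩
    π ^ j ⟨$⟩ʳ (π ^ i ⟨$⟩ʳ v)  ∎
    where open ≡-Reasoning

  ^-fixes : ∀ k {v} → π ⟨$⟩ʳ v ≡ v → π ^ k ⟨$⟩ʳ v ≡ v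
  ^-fixes zero    πv≡v = refl
  ^-fixes (suc k) πv≡v = trans (cong (π ⟨$⟩ʳ_) (^-fixes k πv≡v)) πv≡v

  Moves : Pred (Fin n) 0ℓ
  Moves v = π ⟨$⟩ʳ v ≢ v

  moves? : Decidable Moves
  moves? v = ¬? (π ⟨$⟩ʳ v ≟ v)

  support≡count : support π ≡ count moves?
  support≡count = length-filter-tabulate moves? id

  Invariant : Pred (Fin n) 0ℓ → Set
  Invariant X = ∀ {v} → X v → X (π ⟨$⟩ʳ v)

  Invariant-^ : ∀ {X} → Invariant X → ∀ k {v} → X v → X (π ^ k ⟨$⟩ʳ v)
  Invariant-^ X-inv zero    Xv = Xv
  Invariant-^ {X} X-inv (suc k) Xv = X-inv (Invariant-^ {X} X-inv k Xv)

  IsAut-^ : ∀ Γ → IsAut Γ π → ∀ k → IsAut Γ (π ^ k)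
  IsAut-^ Γ π-aut zero    u v = refl
  IsAut-^ Γ π-aut (suc k) u v = trans (π-aut _ _) (IsAut-^ Γ π-aut k u v)

  adj-fixed : ∀ Γ → IsAut Γ π → ∀ {v} → π ⟨$⟩ʳ v ≡ v →
              ∀ k u → adj Γ (π ^ k ⟨$⟩ʳ u) v ≡ adj Γ u v
  adj-fixed Γ π-aut πv≡v k u =
    trans (cong (adj Γ (π ^ k ⟨$⟩ʳ u)) (sym (^-fixes k πv≡v))) (IsAut-^ Γ π-aut k u _)

  Moves-invariant : Invariant Moves
  Moves-invariant πv≢v ππv≡πv = πv≢v (⟨$⟩ʳ-injective π ππv≡πv)

  Orbit : ℕ → Fin n → Pred (Fin n) 0ℓ
  Orbit k b v = ∃ λ j → j < k × π ^ j ⟨$⟩ʳ b ≡ v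

  orbit? : ∀ k b → Decidable (Orbit k b)
  orbit? k b v = anyUpTo? (λ j → π ^ j ⟨$⟩ʳ b ≟ v) k

  Orbit⊆ : ∀ {X k b} → Invariant X → X b → Orbit k b ⊆ X
  Orbit⊆ {X} X-inv Xb (j , _ , refl) = Invariant-^ {X} X-inv j Xb

  Orbit-suc : ∀ k b → Orbit (suc k) b ≐ Orbit k b ∪ ｛ π ^ k ⟨$⟩ʳ b ｝
  Orbit-suc k b = split , merge
    where
    split : Orbit (suc k) b ⊆ Orbit k b ∪ ｛ π ^ k ⟨$⟩ʳ b ｝
    split (j , j<1+k , e) with m<1+n⇒m<n∨m≡n j<1+k
    ... | inj₁ j<k  = inj₁ (j , j<k , e)
    ... | inj₂ refl = inj₂ e
    merge : Orbit k b ∪ ｛ π ^ k ⟨$⟩ʳ b ｝ ⊆ Orbit (suc k) b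
    merge (inj₁ (j , j<k , e)) = j , m<n⇒m<1+n j<k , e
    merge (inj₂ e)             = k , ≤-refl , e

  record MinimalPeriod (v : Fin n) (L : ℕ) : Set where
    field
      positive : 0 < L
      returns  : π ^ L ⟨$⟩ʳ v ≡ v
      minimal  : ∀ {j} → 0 < j → j < L → π ^ j ⟨$⟩ʳ v ≢ v

  period : ∀ v → ∃ λ L → 0 < L × π ^ L ⟨$⟩ʳ v ≡ v
  period v with pigeonhole (n<1+n n) (λ (i : Fin (suc n)) → π ^ toℕ i ⟨$⟩ʳ v)
  ... | i , j , i<j , πⁱv≡πʲv = toℕ j ∸ toℕ i , m<n⇒0<n∸m i<j ,
    ⟨$⟩ʳ-injective (π ^ toℕ i) (begin
      π ^ toℕ i ⟨$⟩ʳ (π ^ (toℕ j ∸ toℕ i) ⟨$⟩ʳ v)  ≡⟨ ^-+ (toℕ i) (toℕ j ∸ toℕ i) v ⟨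
      π ^ (toℕ i + (toℕ j ∸ toℕ i)) ⟨$⟩ʳ v           ≡⟨ cong (λ k → π ^ k ⟨$⟩ʳ v) (m+[n∸m]≡n (<⇒≤ i<j)) ⟩
      π ^ toℕ j ⟨$⟩ʳ v                                ≡⟨ πⁱv≡πʲv ⟨
      π ^ toℕ i ⟨$⟩ʳ v                                ∎)
    where open ≡-Reasoning

  minimal-period : ∀ v → ∃ (MinimalPeriod v)
  minimal-period v
    with least-witness (λ L → (0 <? L) ×-dec (π ^ L ⟨$⟩ʳ v ≟ v)) (proj₂ (period v))
  ... | L , (0<L , πᴸv≡v) , below = L , record
    { positive = 0<L
    ; returns  = πᴸv≡v
    ; minimal  = λ 0<j j<L πʲv≡v → below j<L (0<j , πʲv≡v)
    }

Moves-^ : ∀ {n} (π : Permutation′ n) k → Moves (π ^ k) ⊆ Moves π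
Moves-^ π k πᵏ-moves-v πv≡v = πᵏ-moves-v (^-fixes π k πv≡v)

module UniformOrbits {n} (π : Permutation′ n) {L : ℕ} (0<L : 0 < L)
  {S : Pred (Fin n) 0ℓ} (S-invariant : Invariant π S)
  (returns   : ∀ {v} → S v → π ^ L ⟨$⟩ʳ v ≡ v)
  (aperiodic : ∀ {v j} → S v → 0 < j → j < L → π ^ j ⟨$⟩ʳ v ≢ v)
  where

  ^-distinct : ∀ {b i k} → S b → i < k → k < L → π ^ i ⟨$⟩ʳ b ≢ π ^ k ⟨$⟩ʳ b
  ^-distinct {b} {i} {k} Sb i<k k<L πⁱb≡πᵏb =
    aperiodic (Invariant-^ π {S} S-invariant i Sb) (m<n⇒0<n∸m i<k) (≤-<-trans (m∸n≤m k i) k<L)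
              πᵏ⁻ⁱ-fixes-πⁱb
    where
    open ≡-Reasoning
    πᵏ⁻ⁱ-fixes-πⁱb : π ^ (k ∸ i) ⟨$⟩ʳ (π ^ i ⟨$⟩ʳ b) ≡ π ^ i ⟨$⟩ʳ b
    πᵏ⁻ⁱ-fixes-πⁱb = begin
      π ^ (k ∸ i) ⟨$⟩ʳ (π ^ i ⟨$⟩ʳ b)  ≡⟨ ^-+ π (k ∸ i) i b ⟨
      π ^ (k ∸ i + i) ⟨$⟩ʳ b            ≡⟨ cong (λ m → π ^ m ⟨$⟩ʳ b) (m∸n+n≡m (<⇒≤ i<k)) ⟩
      π ^ k ⟨$⟩ʳ b                      ≡⟨ πⁱb≡πᵏb ⟨
      π ^ i ⟨$⟩ʳ b                      ∎

  count-Orbit : ∀ {b} → S b → ∀ {k} → k ≤ L → count (orbit? π k b) ≡ k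
  count-Orbit {b} Sb {zero}  _   = count-Empty (orbit? π 0 b) λ _ ()
  count-Orbit {b} Sb {suc k} k<L =
    trans (count-insert (orbit? π k b) (orbit? π (suc k) b) (Orbit-suc π k b) new)
          (cong suc (count-Orbit Sb (<⇒≤ k<L)))
    where
    new : π ^ k ⟨$⟩ʳ b ∉ Orbit π k b
    new (i , i<k , πⁱb≡πᵏb) = ^-distinct Sb i<k k<L πⁱb≡πᵏb

  Orbit-pred : ∀ {b v} → S b → Orbit π L b (π ⟨$⟩ʳ v) → Orbit π L b v
  Orbit-pred {b} {v} Sb (zero , _ , b≡πv) = L ∸ 1 , ∸-monoʳ-< (s≤s z≤n) 0<L ,
    ⟨$⟩ʳ-injective π (begin
      π ⟨$⟩ʳ (π ^ (L ∸ 1) ⟨$⟩ʳ b)  ≡⟨ cong (λ m → π ^ m ⟨$⟩ʳ b) (m+[n∸m]≡n 0<L) ⟩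
      π ^ L ⟨$⟩ʳ b                  ≡⟨ returns Sb ⟩
      b                             ≡⟨ b≡πv ⟩
      π ⟨$⟩ʳ v                      ∎)
    where open ≡-Reasoning
  Orbit-pred Sb (suc j , j<L , πʲ⁺¹b≡πv) = j , <⇒≤ j<L , ⟨$⟩ʳ-injective π πʲ⁺¹b≡πv

  -- By strong induction on count X?, removing the orbit of some b ∈ X, which has L elements.
  L∣count : ∀ {X : Pred (Fin n) 0ℓ} (X? : Decidable X) → X ⊆ S → Invariant π X → L ∣ count X?
  L∣count X? = <-rec Goal step (count X?) X? refl
    where
    Goal : ℕ → Set₁
    Goal m = ∀ {X} (X? : Decidable X) → count X? ≡ m → X ⊆ S → Invariant π X → L ∣ m
    step : ∀ m → (∀ {k} → k < m → Goal k) → Goal m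
    step _ smaller {X} X? refl X⊆S X-inv with any? X?
    ... | no ∄X        = subst (L ∣_) (sym (count-Empty X? λ v Xv → ∄X (v , Xv))) (L ∣0)
    ... | yes (b , Xb) = subst (L ∣_) (sym count≡L+rest) (∣m∣n⇒∣m+n ∣-refl L∣rest)
      where
      O? = orbit? π L b
      rest? = X? ∩? ∁? O?
      Sb = X⊆S Xb
      X∩O≐O : (X ∩ Orbit π L b) ≐ Orbit π L b
      X∩O≐O = proj₂ , λ o → Orbit⊆ π {X} X-inv Xb o , o
      count≡L+rest : count X? ≡ L + count rest?
      count≡L+rest = begin
        count X?                         ≡⟨ count-partition X? O? ⟩
        count (X? ∩? O?) + count rest?   ≡⟨ cong (_+ count rest?) (count-≐ (X? ∩? O?) O? X∩O≐O) ⟩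
        count O? + count rest?           ≡⟨ cong (_+ count rest?) (count-Orbit Sb ≤-refl) ⟩
        L + count rest?                  ∎
        where open ≡-Reasoning
      rest<count : count rest? < count X?
      rest<count = count-< rest? X? proj₁ Xb λ (_ , b∉O) → b∉O (0 , 0<L , refl)
      rest⊆S : (X ∩ ∁ (Orbit π L b)) ⊆ S
      rest⊆S = X⊆S ∘ proj₁
      rest-invariant : Invariant π (X ∩ ∁ (Orbit π L b))
      rest-invariant (Xv , v∉O) = X-inv Xv , v∉O ∘ Orbit-pred Sb
      L∣rest : L ∣ count rest?
      L∣rest = smaller rest<count rest? refl rest⊆S rest-invariant

module Reflection {n} (π : Permutation′ n) (a : Fin n) {L : ℕ} (0<L : 0 < L)
  (π^L≗id : ∀ v → π ^ L ⟨$⟩ʳ v ≡ v)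
  where

  ^-∸-inverseˡ : ∀ {i} → i ≤ L → ∀ v → π ^ (L ∸ i) ⟨$⟩ʳ (π ^ i ⟨$⟩ʳ v) ≡ v
  ^-∸-inverseˡ {i} i≤L v = begin
    π ^ (L ∸ i) ⟨$⟩ʳ (π ^ i ⟨$⟩ʳ v)  ≡⟨ sym (^-+ π (L ∸ i) i v) ⟩
    π ^ (L ∸ i + i) ⟨$⟩ʳ v            ≡⟨ cong (λ m → π ^ m ⟨$⟩ʳ v) (m∸n+n≡m i≤L) ⟩
    π ^ L ⟨$⟩ʳ v                      ≡⟨ π^L≗id v ⟩
    v                                 ∎
    where open ≡-Reasoning

  ^-∸-inverseʳ : ∀ {i} → i ≤ L → ∀ v → π ^ i ⟨$⟩ʳ (π ^ (L ∸ i) ⟨$⟩ʳ v) ≡ v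
  ^-∸-inverseʳ {i} i≤L v = trans (^-comm π i (L ∸ i) v) (^-∸-inverseˡ i≤L v)

  Orbit-^ : ∀ {i} → i ≤ L → Orbit π L a (π ^ i ⟨$⟩ʳ a)
  Orbit-^ {i} i≤L with m≤n⇒m<n∨m≡n i≤L
  ... | inj₁ i<L  = i , i<L , refl
  ... | inj₂ refl = 0 , 0<L , sym (π^L≗id a)

  reflect : Fin n → Fin n
  reflect v with orbit? π L a v
  ... | yes (i , _ , _) = π ^ (L ∸ i) ⟨$⟩ʳ a
  ... | no  _           = v

  reflect-^ : ∀ {i} → i ≤ L → reflect (π ^ i ⟨$⟩ʳ a) ≡ π ^ (L ∸ i) ⟨$⟩ʳ a
  reflect-^ {i} i≤L with orbit? π L a (π ^ i ⟨$⟩ʳ a)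
  ... | no ∉Orbit               = contradiction (Orbit-^ i≤L) ∉Orbit
  ... | yes (j , j<L , πʲa≡πⁱa) = begin
    π ^ (L ∸ j) ⟨$⟩ʳ a
      ≡⟨ cong (π ^ (L ∸ j) ⟨$⟩ʳ_) (^-∸-inverseˡ i≤L a) ⟨
    π ^ (L ∸ j) ⟨$⟩ʳ (π ^ (L ∸ i) ⟨$⟩ʳ (π ^ i ⟨$⟩ʳ a))
      ≡⟨ ^-comm π (L ∸ j) (L ∸ i) _ ⟩
    π ^ (L ∸ i) ⟨$⟩ʳ (π ^ (L ∸ j) ⟨$⟩ʳ (π ^ i ⟨$⟩ʳ a))
      ≡⟨ cong (λ w → π ^ (L ∸ i) ⟨$⟩ʳ (π ^ (L ∸ j) ⟨$⟩ʳ w)) πʲa≡πⁱa ⟨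
    π ^ (L ∸ i) ⟨$⟩ʳ (π ^ (L ∸ j) ⟨$⟩ʳ (π ^ j ⟨$⟩ʳ a))
      ≡⟨ cong (π ^ (L ∸ i) ⟨$⟩ʳ_) (^-∸-inverseˡ (<⇒≤ j<L) a) ⟩
    π ^ (L ∸ i) ⟨$⟩ʳ a
      ∎
    where open ≡-Reasoning

  reflect-outside : ∀ {v} → v ∉ Orbit π L a → reflect v ≡ v
  reflect-outside {v} v∉O with orbit? π L a v
  ... | yes v∈O = contradiction v∈O v∉O
  ... | no  _   = refl

  reflect-involutive : ∀ v → reflect (reflect v) ≡ v
  reflect-involutive v with orbit? π L a v
  ... | yes (i , i<L , refl) =
    trans (reflect-^ (m∸n≤m L i)) (cong (λ m → π ^ m ⟨$⟩ʳ a) (m∸[m∸n]≡n (<⇒≤ i<L)))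
  ... | no  v∉O              = reflect-outside v∉O

  reflection : Permutation′ n
  reflection = permutation reflect reflect reflect-involutive reflect-involutive

  reflection-fixes : reflection ⟨$⟩ʳ a ≡ a
  reflection-fixes = trans (reflect-^ z≤n) (π^L≗id a)

  reflection-moves : π ^ 2 ⟨$⟩ʳ a ≢ a → Moves reflection (π ⟨$⟩ʳ a)
  reflection-moves π²a≢a reflect-πa≡πa = π²a≢a (begin
    π ⟨$⟩ʳ (π ⟨$⟩ʳ a)                ≡⟨ cong (π ⟨$⟩ʳ_) (sym reflect-πa≡πa) ⟩
    π ⟨$⟩ʳ reflect (π ⟨$⟩ʳ a)        ≡⟨ cong (π ⟨$⟩ʳ_) (reflect-^ 0<L) ⟩
    π ⟨$⟩ʳ (π ^ (L ∸ 1) ⟨$⟩ʳ a)      ≡⟨ ^-∸-inverseʳ 0<L a ⟩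
    a                                ∎)
    where open ≡-Reasoning

  Moves-reflection⊆Orbit : Moves reflection ⊆ Orbit π L a
  Moves-reflection⊆Orbit {v} moved = decidable-stable (orbit? π L a v) (moved ∘ reflect-outside)

  module _ (Γ : Graph n) (π-aut : IsAut Γ π)
           (fixed-outside : ∀ {v} → v ∉ Orbit π L a → π ⟨$⟩ʳ v ≡ v) where

    adj-reflected : ∀ {i j} → i ≤ L → j ≤ L →
                    adj Γ (π ^ (L ∸ i) ⟨$⟩ʳ a) (π ^ (L ∸ j) ⟨$⟩ʳ a) ≡
                    adj Γ (π ^ i ⟨$⟩ʳ a) (π ^ j ⟨$⟩ʳ a)
    adj-reflected {i} {j} i≤L j≤L = begin
      adj Γ (π ^ (L ∸ i) ⟨$⟩ʳ a) (π ^ (L ∸ j) ⟨$⟩ʳ a)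
        ≡⟨ IsAut-^ π Γ π-aut (i + j) _ _ ⟨
      adj Γ (π ^ (i + j) ⟨$⟩ʳ (π ^ (L ∸ i) ⟨$⟩ʳ a)) (π ^ (i + j) ⟨$⟩ʳ (π ^ (L ∸ j) ⟨$⟩ʳ a))
        ≡⟨ cong₂ (adj Γ) first second ⟩
      adj Γ (π ^ j ⟨$⟩ʳ a) (π ^ i ⟨$⟩ʳ a)
        ≡⟨ adj-sym Γ _ _ ⟩
      adj Γ (π ^ i ⟨$⟩ʳ a) (π ^ j ⟨$⟩ʳ a)
        ∎
      where
      open ≡-Reasoning
      πᴸ⁻ⁱa = π ^ (L ∸ i) ⟨$⟩ʳ a
      first : π ^ (i + j) ⟨$⟩ʳ (π ^ (L ∸ i) ⟨$⟩ʳ a) ≡ π ^ j ⟨$⟩ʳ a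
      first = begin
        π ^ (i + j) ⟨$⟩ʳ (π ^ (L ∸ i) ⟨$⟩ʳ a)         ≡⟨ cong (λ m → π ^ m ⟨$⟩ʳ πᴸ⁻ⁱa) (+-comm i j) ⟩
        π ^ (j + i) ⟨$⟩ʳ (π ^ (L ∸ i) ⟨$⟩ʳ a)         ≡⟨ ^-+ π j i _ ⟩
        π ^ j ⟨$⟩ʳ (π ^ i ⟨$⟩ʳ (π ^ (L ∸ i) ⟨$⟩ʳ a))  ≡⟨ cong (π ^ j ⟨$⟩ʳ_) (^-∸-inverseʳ i≤L a) ⟩
        π ^ j ⟨$⟩ʳ a                                   ∎
      second : π ^ (i + j) ⟨$⟩ʳ (π ^ (L ∸ j) ⟨$⟩ʳ a) ≡ π ^ i ⟨$⟩ʳ a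
      second = trans (^-+ π i j _) (cong (π ^ i ⟨$⟩ʳ_) (^-∸-inverseʳ j≤L a))

    adj-reflected-fixed : ∀ {i v} → i ≤ L → v ∉ Orbit π L a →
                          adj Γ (π ^ (L ∸ i) ⟨$⟩ʳ a) v ≡ adj Γ (π ^ i ⟨$⟩ʳ a) v
    adj-reflected-fixed {i} i≤L v∉O =
      trans (adj-fixed π Γ π-aut πv≡v (L ∸ i) a) (sym (adj-fixed π Γ π-aut πv≡v i a))
      where πv≡v = fixed-outside v∉O

    reflection-aut : IsAut Γ reflection
    reflection-aut u v with orbit? π L a u | orbit? π L a v
    ... | yes (i , i<L , refl) | yes (j , j<L , refl) = adj-reflected (<⇒≤ i<L) (<⇒≤ j<L)
    ... | yes (i , i<L , refl) | no v∉O              = adj-reflected-fixed (<⇒≤ i<L) v∉O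
    ... | no u∉O               | yes (j , j<L , refl) =
      trans (adj-sym Γ _ _) (trans (adj-reflected-fixed (<⇒≤ j<L) u∉O) (adj-sym Γ _ _))
    ... | no _                 | no _                 = refl

module MinimalSupport {n} (Γ : Graph n) (σ : Permutation′ n) (σ-aut : IsAut Γ σ)
  (σ-minimal : ∀ τ → IsAut Γ τ → NonIdentity τ → support σ ≤ support τ)
  where

  smaller-support⇒identity : ∀ τ → IsAut Γ τ → Moves τ ⊆ Moves σ →
                             ∀ {a} → Moves σ a → τ ⟨$⟩ʳ a ≡ a → ∀ v → τ ⟨$⟩ʳ v ≡ v
  smaller-support⇒identity τ τ-aut τ⊆σ {a} σ-moves-a τa≡a v =
    decidable-stable (τ ⟨$⟩ʳ v ≟ v) λ τ-moves-v →
      <⇒≱ support-τ<support-σ (σ-minimal τ τ-aut (v , τ-moves-v))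
    where
    support-τ<support-σ : support τ < support σ
    support-τ<support-σ = begin-strict
      support τ         ≡⟨ support≡count τ ⟩
      count (moves? τ)  <⟨ count-< (moves? τ) (moves? σ) τ⊆σ σ-moves-a (_$ τa≡a) ⟩
      count (moves? σ)  ≡⟨ support≡count σ ⟨
      support σ         ∎
      where open ≤-Reasoning

  module Cycle {a} (a-moved : Moves σ a) {L} (L-period : MinimalPeriod σ a L) where
    open MinimalPeriod L-period

    σ^L≗id : ∀ v → σ ^ L ⟨$⟩ʳ v ≡ v
    σ^L≗id = smaller-support⇒identity (σ ^ L) (IsAut-^ σ Γ σ-aut L) (Moves-^ σ L)
                                      a-moved returns

    aperiodic : ∀ {v j} → Moves σ v → 0 < j → j < L → σ ^ j ⟨$⟩ʳ v ≢ v
    aperiodic {j = j} v-moved 0<j j<L σʲv≡v = minimal 0<j j<L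
      (smaller-support⇒identity (σ ^ j) (IsAut-^ σ Γ σ-aut j) (Moves-^ σ j) v-moved σʲv≡v a)

    open UniformOrbits σ positive (Moves-invariant σ) (λ {v} _ → σ^L≗id v) aperiodic

    L∣support : L ∣ support σ
    L∣support = subst (L ∣_) (sym (support≡count σ)) (L∣count (moves? σ) id (Moves-invariant σ))

    L≢1 : L ≢ 1
    L≢1 refl = a-moved returns

    Orbit⊆Moves : Orbit σ L a ⊆ Moves σ
    Orbit⊆Moves = Orbit⊆ σ {Moves σ} (Moves-invariant σ) a-moved

    module _ (L≡support : L ≡ support σ) where

      Moves⊆Orbit : Moves σ ⊆ Orbit σ L a
      Moves⊆Orbit {v} v-moved = decidable-stable (orbit? σ L a v) λ v∉O →
        <-irrefl count-Orbit≡count-Moves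
          (count-< (orbit? σ L a) (moves? σ) Orbit⊆Moves v-moved v∉O)
        where
        count-Orbit≡count-Moves : count (orbit? σ L a) ≡ count (moves? σ)
        count-Orbit≡count-Moves =
          trans (count-Orbit a-moved ≤-refl) (trans L≡support (support≡count σ))

      L≤2 : L ≤ 2
      L≤2 = ≮⇒≥ λ 2<L → reflection-moves (minimal (s≤s z≤n) 2<L)
        (smaller-support⇒identity reflection (reflection-aut Γ σ-aut fixed-outside)
           (Orbit⊆Moves ∘ Moves-reflection⊆Orbit) a-moved reflection-fixes (σ ⟨$⟩ʳ a))
        where
        open Reflection σ a positive σ^L≗id
        fixed-outside : ∀ {v} → v ∉ Orbit σ L a → σ ⟨$⟩ʳ v ≡ v
        fixed-outside {v} v∉O = decidable-stable (σ ⟨$⟩ʳ v ≟ v) (v∉O ∘ Moves⊆Orbit)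

    support≡2 : Prime (support σ) → support σ ≡ 2
    support≡2 prime-support with prime⇒irreducible prime-support L∣support
    ... | inj₁ L≡1       = contradiction L≡1 L≢1
    ... | inj₂ L≡support = ≤-antisym (subst (_≤ 2) L≡support (L≤2 L≡support))
                                     (nonTrivial⇒n>1 (support σ) {{prime⇒nonTrivial prime-support}})

  prime-support⇒support≡2 : NonIdentity σ → Prime (support σ) → support σ ≡ 2
  prime-support⇒support≡2 (a , a-moved) = Cycle.support≡2 a-moved (proj₂ (minimal-period σ a))

corollary1p2 : ∀ {n : ℕ} (Γ : Graph n) → VertexTransitive Γ →
                 ∀ (p : ℕ) → Prime p → p ≢ 2 → ¬ MotionIs Γ p
corollary1p2 Γ _ p p-prime p≢2 ((σ , σ-aut , σ≢id , support≡p) , p-minimal) =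
  p≢2 (trans (sym support≡p) (prime-support⇒support≡2 σ≢id (subst Prime (sym support≡p) p-prime)))
  where
  σ-minimal : ∀ τ → IsAut Γ τ → NonIdentity τ → support σ ≤ support τ
  σ-minimal τ τ-aut τ≢id = subst (_≤ support τ) (sym support≡p) (p-minimal τ τ-aut τ≢id)
  open MinimalSupport Γ σ σ-aut σ-minimal
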